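{- For the Boolean lattice $B_n$ (all subsets of an $n$-element set ordered by inclusion), $\mathcal{M}(B_n,t)=(t+1)^n(t-1)^{2n}$.
   Context: For a ranked finite poset $\mathcal{S}$ with rank function $\mathrm{rk}$ and rank $\mathrm{rk}(\mathcal{S})$, $\mathcal{F}l^3(\mathcal{S})=\{(x,y,z):x\le y\le z\}$, $J$ is defined on $\mathcal{F}l^3(\mathcal{S})$ by $\sum_{x\le a\le y\le b\le z}J(a,y,b)=\delta_3(x,y,z)$ ($\delta_3(x,y,z)=1$ iff $x=y=z$, else $0$), and $\mathcal{M}(\mathcal{S},t)=\sum_{(x,y,z)\in\mathcal{F}l^3(\mathcal{S})}J(x,y,z)\,t^{3\mathrm{rk}(\mathcal{S})-\mathrm{rk}(x)-\mathrm{rk}(y)-\mathrm{rk}(z)}$. In $B_n$ the rank of a subset is its cardinality. -}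

module Defs where

open import Data.Bool using (Bool; true; false)
import Data.Bool.Properties as BoolP
open import Data.Nat using (ℕ; zero; suc; _∸_)
import Data.Nat as N
open import Data.Integer using (ℤ; _+_; _*_; _-_; _^_; 0ℤ; 1ℤ)
open import Data.List using (List; []; _∷_; map; _++_; filter)
open import Data.Fin.Subset using (Subset; _⊆_; ∣_∣)
open import Data.Fin.Subset.Properties using (_⊆?_)
open import Data.Vec using ([]; _∷_)
open import Data.Vec.Properties using (≡-dec)
open import Relation.Nullary using (yes; no; Dec)
open import Relation.Binary.PropositionalEquality using (_≡_)

-- The Boolean lattice B_n: subsets of Fin n ordered by inclusion ⊆,
-- rank of a subset = its cardinality ∣_∣, rank of B_n = n.

allSubsets : (n : ℕ) → List (Subset n)
allSubsets zero = [] ∷ []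
allSubsets (suc n) = map (true ∷_) (allSubsets n) ++ map (false ∷_) (allSubsets n)

sumℤ : List ℤ → ℤ
sumℤ [] = 0ℤ
sumℤ (x ∷ xs) = x + sumℤ xs

sumInterval : {n : ℕ} → Subset n → Subset n → (Subset n → ℤ) → ℤ
sumInterval {n} x y f =
  sumℤ (map f (filter (λ a → x ⊆? a) (filter (λ a → a ⊆? y) (allSubsets n))))

_≟S_ : {n : ℕ} → (x y : Subset n) → Dec (x ≡ y)
_≟S_ = ≡-dec BoolP._≟_

δ₃ : {n : ℕ} → Subset n → Subset n → Subset n → ℤ
δ₃ x y z with x ≟S y | y ≟S z
... | yes _ | yes _ = 1ℤ
... | _     | _     = 0ℤ

-- J satisfies the defining relation on 𝓕l³(B_n):
-- for all x ≤ y ≤ z,  Σ_{x ≤ a ≤ y ≤ b ≤ z} J(a,y,b) = δ₃(x,y,z).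
IsJ : (n : ℕ) → (Subset n → Subset n → Subset n → ℤ) → Set
IsJ n J = (x y z : Subset n) → x ⊆ y → y ⊆ z →
  sumInterval x y (λ a → sumInterval y z (λ b → J a y b)) ≡ δ₃ x y z

-- 𝓜(B_n, t) = Σ_{(x,y,z) ∈ 𝓕l³(B_n)} J(x,y,z) t^{3n - |x| - |y| - |z|},
-- evaluated at an integer t.
M : (n : ℕ) → (Subset n → Subset n → Subset n → ℤ) → ℤ → ℤ
M n J t =
  sumInterval (Data.Vec.replicate n false) (Data.Vec.replicate n true) (λ y →
    sumInterval (Data.Vec.replicate n false) y (λ x →
      sumInterval y (Data.Vec.replicate n true) (λ z →
        J x y z * (t ^ (3 N.* n ∸ ∣ x ∣ ∸ ∣ y ∣ ∸ ∣ z ∣)))))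
  where import Data.Vec

-- Put W x = t ^ (n - |x|), the product over the coordinates of 1 (inside x) or t
-- (outside x). W is also the sum over a ⊆ x of ∏ᵢ (aᵢ ? 1 - t : t) and the sum over
-- b ⊇ x of ∏ᵢ (bᵢ ? 1 : t - 1). Substituting these sums for W x and W z and
-- interchanging the summations, the defining relation of J turns the weighted sum
-- over the flags x ⊆ y ⊆ z into δ₃, so 𝓜 collapses to a sum over y of a product of
-- coordinate weights. That sum factors as ((1 - t) + t · t · (t - 1)) ^ n,
-- and (1 - t) + t²(t - 1) = (t + 1)(t - 1)².
module Submission where

open import Defs
open import Data.Bool using (Bool; true; false; if_then_else_)
open import Data.Nat using (ℕ; zero; suc; _∸_; _≤_)
import Data.Nat
import Data.Nat as ℕ
import Data.Nat.Properties as ℕP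
open import Data.Integer using (ℤ; _+_; _-_; _*_; _^_; 0ℤ; 1ℤ)
import Data.Integer.Properties as ℤP
open import Data.Integer.Tactic.RingSolver using (solve-∀)
open import Data.List using (List; []; _∷_; map; _++_; filter)
import Data.List.Properties as ListP
open import Data.Fin.Subset using (Subset; _⊆_; ∣_∣; ⊥; ⊤)
open import Data.Fin.Subset.Properties
  using (_⊆?_; s⊆s; out⊆; drop-∷-⊆; ⊆-refl; ⊥⊆; ⊆⊤; ∣p∣≤n)
open import Data.Vec using ([]; _∷_; here)
open import Data.Empty using (⊥-elim)
open import Function using (_∘_)
open import Algebra.Properties.CommutativeSemigroup ℤP.+-commutativeSemigroup
  using () renaming (interchange to +-interchange)
open import Algebra.Properties.CommutativeSemigroup ℤP.*-commutativeSemigroup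
  using () renaming (interchange to *-interchange)
open import Relation.Nullary using (Dec; yes; no; does)
open import Level using (0ℓ)
open import Relation.Unary using (Pred; Decidable)
open import Relation.Binary.PropositionalEquality
  using (_≡_; refl; sym; trans; cong; cong₂; module ≡-Reasoning)

private
  variable
    n : ℕ

-- The interval [l, u] of B_n is the product of the intervals [lᵢ, uᵢ] of B_1.
intervalSum : Subset n → Subset n → (Subset n → ℤ) → ℤ
intervalSum []          []          f = f []
intervalSum (true ∷ l)  (true ∷ u)  f = intervalSum l u (f ∘ (true ∷_))
intervalSum (true ∷ l)  (false ∷ u) f = 0ℤ
intervalSum (false ∷ l) (true ∷ u)  f =
  intervalSum l u (f ∘ (true ∷_)) + intervalSum l u (f ∘ (false ∷_))
intervalSum (false ∷ l) (false ∷ u) f = intervalSum l u (f ∘ (false ∷_))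

syntax intervalSum l u (λ a → e) = ∑[ a ∈ l ⋯ u ] e

intervalSum-cong : (l u : Subset n) {f g : Subset n → ℤ} → (∀ v → f v ≡ g v) →
                   intervalSum l u f ≡ intervalSum l u g
intervalSum-cong []          []          f≗g = f≗g []
intervalSum-cong (true ∷ l)  (true ∷ u)  f≗g = intervalSum-cong l u (f≗g ∘ (true ∷_))
intervalSum-cong (true ∷ l)  (false ∷ u) f≗g = refl
intervalSum-cong (false ∷ l) (true ∷ u)  f≗g =
  cong₂ _+_ (intervalSum-cong l u (f≗g ∘ (true ∷_))) (intervalSum-cong l u (f≗g ∘ (false ∷_)))
intervalSum-cong (false ∷ l) (false ∷ u) f≗g = intervalSum-cong l u (f≗g ∘ (false ∷_))

intervalSum-cong-⊆ : (l u : Subset n) {f g : Subset n → ℤ} → (∀ v → l ⊆ v → v ⊆ u → f v ≡ g v) →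
                     intervalSum l u f ≡ intervalSum l u g
intervalSum-cong-⊆ []          []          f≗g = f≗g [] (λ ()) (λ ())
intervalSum-cong-⊆ (true ∷ l)  (true ∷ u)  f≗g =
  intervalSum-cong-⊆ l u (λ v l⊆v v⊆u → f≗g (true ∷ v) (s⊆s l⊆v) (s⊆s v⊆u))
intervalSum-cong-⊆ (true ∷ l)  (false ∷ u) f≗g = refl
intervalSum-cong-⊆ (false ∷ l) (true ∷ u)  f≗g = cong₂ _+_
  (intervalSum-cong-⊆ l u (λ v l⊆v v⊆u → f≗g (true ∷ v) (out⊆ l⊆v) (s⊆s v⊆u)))
  (intervalSum-cong-⊆ l u (λ v l⊆v v⊆u → f≗g (false ∷ v) (out⊆ l⊆v) (out⊆ v⊆u)))
intervalSum-cong-⊆ (false ∷ l) (false ∷ u) f≗g =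
  intervalSum-cong-⊆ l u (λ v l⊆v v⊆u → f≗g (false ∷ v) (out⊆ l⊆v) (out⊆ v⊆u))

intervalSum-zero : (l u : Subset n) → ∑[ v ∈ l ⋯ u ] 0ℤ ≡ 0ℤ
intervalSum-zero []          []          = refl
intervalSum-zero (true ∷ l)  (true ∷ u)  = intervalSum-zero l u
intervalSum-zero (true ∷ l)  (false ∷ u) = refl
intervalSum-zero (false ∷ l) (true ∷ u)  = cong₂ _+_ (intervalSum-zero l u) (intervalSum-zero l u)
intervalSum-zero (false ∷ l) (false ∷ u) = intervalSum-zero l u

intervalSum-+ : (l u : Subset n) (f g : Subset n → ℤ) →
                ∑[ v ∈ l ⋯ u ] (f v + g v) ≡ intervalSum l u f + intervalSum l u g
intervalSum-+ []          []          f g = refl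
intervalSum-+ (true ∷ l)  (true ∷ u)  f g = intervalSum-+ l u _ _
intervalSum-+ (true ∷ l)  (false ∷ u) f g = refl
intervalSum-+ (false ∷ l) (true ∷ u)  f g =
  trans (cong₂ _+_ (intervalSum-+ l u (f ∘ (true ∷_)) (g ∘ (true ∷_)))
                   (intervalSum-+ l u (f ∘ (false ∷_)) (g ∘ (false ∷_))))
        (+-interchange (intervalSum l u (f ∘ (true ∷_))) _ _ _)
intervalSum-+ (false ∷ l) (false ∷ u) f g = intervalSum-+ l u _ _

intervalSum-*ˡ : (l u : Subset n) (c : ℤ) (f : Subset n → ℤ) →
                 ∑[ v ∈ l ⋯ u ] (c * f v) ≡ c * intervalSum l u f
intervalSum-*ˡ []          []          c f = refl
intervalSum-*ˡ (true ∷ l)  (true ∷ u)  c f = intervalSum-*ˡ l u c _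
intervalSum-*ˡ (true ∷ l)  (false ∷ u) c f = sym (ℤP.*-zeroʳ c)
intervalSum-*ˡ (false ∷ l) (true ∷ u)  c f =
  trans (cong₂ _+_ (intervalSum-*ˡ l u c _) (intervalSum-*ˡ l u c _)) (sym (ℤP.*-distribˡ-+ c _ _))
intervalSum-*ˡ (false ∷ l) (false ∷ u) c f = intervalSum-*ˡ l u c _

intervalSum-*ʳ : (l u : Subset n) (c : ℤ) (f : Subset n → ℤ) →
                 ∑[ v ∈ l ⋯ u ] (f v * c) ≡ intervalSum l u f * c
intervalSum-*ʳ l u c f = begin
  ∑[ v ∈ l ⋯ u ] (f v * c)  ≡⟨ intervalSum-cong l u (λ v → ℤP.*-comm (f v) c) ⟩
  ∑[ v ∈ l ⋯ u ] (c * f v)  ≡⟨ intervalSum-*ˡ l u c f ⟩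
  c * intervalSum l u f     ≡⟨ ℤP.*-comm c _ ⟩
  intervalSum l u f * c     ∎
  where open ≡-Reasoning

intervalSum-comm : ∀ {m} (l u : Subset n) (l′ u′ : Subset m) (f : Subset n → Subset m → ℤ) →
  ∑[ v ∈ l ⋯ u ] ∑[ w ∈ l′ ⋯ u′ ] f v w ≡ ∑[ w ∈ l′ ⋯ u′ ] ∑[ v ∈ l ⋯ u ] f v w
intervalSum-comm []          []          l′ u′ f = refl
intervalSum-comm (true ∷ l)  (true ∷ u)  l′ u′ f = intervalSum-comm l u l′ u′ _
intervalSum-comm (true ∷ l)  (false ∷ u) l′ u′ f = sym (intervalSum-zero l′ u′)
intervalSum-comm (false ∷ l) (true ∷ u)  l′ u′ f =
  trans (cong₂ _+_ (intervalSum-comm l u l′ u′ _) (intervalSum-comm l u l′ u′ _))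
        (sym (intervalSum-+ l′ u′ _ _))
intervalSum-comm (false ∷ l) (false ∷ u) l′ u′ f = intervalSum-comm l u l′ u′ _

intervalSum-triangle : (l y : Subset n) (g : Subset n → Subset n → ℤ) →
  ∑[ a ∈ l ⋯ y ] ∑[ x ∈ l ⋯ a ] g x a ≡ ∑[ x ∈ l ⋯ y ] ∑[ a ∈ x ⋯ y ] g x a
intervalSum-triangle []          []          g = refl
intervalSum-triangle (true ∷ l)  (true ∷ y)  g = intervalSum-triangle l y _
intervalSum-triangle (true ∷ l)  (false ∷ y) g = refl
intervalSum-triangle (false ∷ l) (false ∷ y) g = intervalSum-triangle l y _
intervalSum-triangle (false ∷ l) (true ∷ y)  g = begin
  ∑[ a ∈ l ⋯ y ] (∑[ x ∈ l ⋯ a ] g₁₁ x a + ∑[ x ∈ l ⋯ a ] g₀₁ x a)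
    + ∑[ a ∈ l ⋯ y ] ∑[ x ∈ l ⋯ a ] g₀₀ x a
    ≡⟨ cong (_+ ∑[ a ∈ l ⋯ y ] ∑[ x ∈ l ⋯ a ] g₀₀ x a)
            (intervalSum-+ l y (λ a → ∑[ x ∈ l ⋯ a ] g₁₁ x a) (λ a → ∑[ x ∈ l ⋯ a ] g₀₁ x a)) ⟩
  (∑[ a ∈ l ⋯ y ] ∑[ x ∈ l ⋯ a ] g₁₁ x a + ∑[ a ∈ l ⋯ y ] ∑[ x ∈ l ⋯ a ] g₀₁ x a)
    + ∑[ a ∈ l ⋯ y ] ∑[ x ∈ l ⋯ a ] g₀₀ x a
    ≡⟨ cong₂ _+_ (cong₂ _+_ (intervalSum-triangle l y g₁₁) (intervalSum-triangle l y g₀₁))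
                 (intervalSum-triangle l y g₀₀) ⟩
  (∑[ x ∈ l ⋯ y ] ∑[ a ∈ x ⋯ y ] g₁₁ x a + ∑[ x ∈ l ⋯ y ] ∑[ a ∈ x ⋯ y ] g₀₁ x a)
    + ∑[ x ∈ l ⋯ y ] ∑[ a ∈ x ⋯ y ] g₀₀ x a
    ≡⟨ ℤP.+-assoc (∑[ x ∈ l ⋯ y ] ∑[ a ∈ x ⋯ y ] g₁₁ x a) _ _ ⟩
  ∑[ x ∈ l ⋯ y ] ∑[ a ∈ x ⋯ y ] g₁₁ x a
    + (∑[ x ∈ l ⋯ y ] ∑[ a ∈ x ⋯ y ] g₀₁ x a + ∑[ x ∈ l ⋯ y ] ∑[ a ∈ x ⋯ y ] g₀₀ x a)
    ≡⟨ cong (∑[ x ∈ l ⋯ y ] ∑[ a ∈ x ⋯ y ] g₁₁ x a +_)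
            (sym (intervalSum-+ l y (λ x → ∑[ a ∈ x ⋯ y ] g₀₁ x a) (λ x → ∑[ a ∈ x ⋯ y ] g₀₀ x a))) ⟩
  ∑[ x ∈ l ⋯ y ] ∑[ a ∈ x ⋯ y ] g₁₁ x a
    + ∑[ x ∈ l ⋯ y ] (∑[ a ∈ x ⋯ y ] g₀₁ x a + ∑[ a ∈ x ⋯ y ] g₀₀ x a) ∎
  where
  open ≡-Reasoning
  g₁₁ g₀₁ g₀₀ : Subset _ → Subset _ → ℤ
  g₁₁ x a = g (true ∷ x) (true ∷ a)
  g₀₁ x a = g (false ∷ x) (true ∷ a)
  g₀₀ x a = g (false ∷ x) (false ∷ a)

intervalSum²-*ˡ : (l u l′ u′ : Subset n) (c : ℤ) (f : Subset n → Subset n → ℤ) →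
  ∑[ x ∈ l ⋯ u ] ∑[ z ∈ l′ ⋯ u′ ] (c * f x z) ≡ c * ∑[ x ∈ l ⋯ u ] ∑[ z ∈ l′ ⋯ u′ ] f x z
intervalSum²-*ˡ l u l′ u′ c f =
  trans (intervalSum-cong l u (λ x → intervalSum-*ˡ l′ u′ c (f x))) (intervalSum-*ˡ l u c _)

intervalSum²-*ʳ : (l u l′ u′ : Subset n) (c : ℤ) (f : Subset n → Subset n → ℤ) →
  ∑[ x ∈ l ⋯ u ] ∑[ z ∈ l′ ⋯ u′ ] (f x z * c) ≡ (∑[ x ∈ l ⋯ u ] ∑[ z ∈ l′ ⋯ u′ ] f x z) * c
intervalSum²-*ʳ l u l′ u′ c f =
  trans (intervalSum-cong l u (λ x → intervalSum-*ʳ l′ u′ c (f x))) (intervalSum-*ʳ l u c _)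

intervalSum-*-intervalSum : (l u l′ u′ : Subset n) (f g : Subset n → ℤ) →
  intervalSum l u f * intervalSum l′ u′ g ≡ ∑[ x ∈ l ⋯ u ] ∑[ z ∈ l′ ⋯ u′ ] (f x * g z)
intervalSum-*-intervalSum l u l′ u′ f g =
  sym (trans (intervalSum-cong l u (λ x → intervalSum-*ˡ l′ u′ (f x) g)) (intervalSum-*ʳ l u _ f))

𝟙 : {P : Set} → Dec P → ℤ
𝟙 P? = if does P? then 1ℤ else 0ℤ

δ₃≡𝟙*𝟙 : (x y z : Subset n) → δ₃ x y z ≡ 𝟙 (x ≟S y) * 𝟙 (z ≟S y)
δ₃≡𝟙*𝟙 x y z with x ≟S y | y ≟S z | z ≟S y
... | yes _ | yes _   | yes _   = refl
... | yes _ | yes y≡z | no z≢y  = ⊥-elim (z≢y (sym y≡z))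
... | yes _ | no y≢z  | yes z≡y = ⊥-elim (y≢z (sym z≡y))
... | yes _ | no _    | no _    = refl
... | no _  | _       | _       = refl

intervalSum-δ : (l u y : Subset n) (f : Subset n → ℤ) → l ⊆ y → y ⊆ u →
                ∑[ x ∈ l ⋯ u ] (𝟙 (x ≟S y) * f x) ≡ f y
intervalSum-δ []          []          []          f _ _ = ℤP.*-identityˡ (f [])
intervalSum-δ (true ∷ l)  (true ∷ u)  (true ∷ y)  f l⊆y y⊆u =
  intervalSum-δ l u y _ (drop-∷-⊆ l⊆y) (drop-∷-⊆ y⊆u)
intervalSum-δ (false ∷ l) (false ∷ u) (false ∷ y) f l⊆y y⊆u =
  intervalSum-δ l u y _ (drop-∷-⊆ l⊆y) (drop-∷-⊆ y⊆u)
intervalSum-δ (false ∷ l) (true ∷ u)  (true ∷ y)  f l⊆y y⊆u =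
  trans (cong₂ _+_ (intervalSum-δ l u y _ (drop-∷-⊆ l⊆y) (drop-∷-⊆ y⊆u)) (intervalSum-zero l u))
        (ℤP.+-identityʳ _)
intervalSum-δ (false ∷ l) (true ∷ u)  (false ∷ y) f l⊆y y⊆u =
  trans (cong₂ _+_ (intervalSum-zero l u) (intervalSum-δ l u y _ (drop-∷-⊆ l⊆y) (drop-∷-⊆ y⊆u)))
        (ℤP.+-identityˡ _)
intervalSum-δ (true ∷ l)  _           (false ∷ y) f l⊆y _   with () ← l⊆y here
intervalSum-δ _           (false ∷ u) (true ∷ y)  f _   y⊆u with () ← y⊆u here

intervalSum²-δ₃ : (l u y : Subset n) (f : Subset n → Subset n → ℤ) → l ⊆ y → y ⊆ u →
  ∑[ x ∈ l ⋯ y ] ∑[ z ∈ y ⋯ u ] (δ₃ x y z * f x z) ≡ f y y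
intervalSum²-δ₃ l u y f l⊆y y⊆u = begin
  ∑[ x ∈ l ⋯ y ] ∑[ z ∈ y ⋯ u ] (δ₃ x y z * f x z)
    ≡⟨ intervalSum-cong l y (λ x → intervalSum-cong y u (λ z →
         trans (cong (_* f x z) (δ₃≡𝟙*𝟙 x y z)) (ℤP.*-assoc (𝟙 (x ≟S y)) _ _))) ⟩
  ∑[ x ∈ l ⋯ y ] ∑[ z ∈ y ⋯ u ] (𝟙 (x ≟S y) * (𝟙 (z ≟S y) * f x z))
    ≡⟨ intervalSum-cong l y (λ x → intervalSum-*ˡ y u (𝟙 (x ≟S y)) _) ⟩
  ∑[ x ∈ l ⋯ y ] (𝟙 (x ≟S y) * ∑[ z ∈ y ⋯ u ] (𝟙 (z ≟S y) * f x z))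
    ≡⟨ intervalSum-cong l y (λ x → cong (𝟙 (x ≟S y) *_) (intervalSum-δ y u y (f x) ⊆-refl y⊆u)) ⟩
  ∑[ x ∈ l ⋯ y ] (𝟙 (x ≟S y) * f x y)
    ≡⟨ intervalSum-δ l y y (λ x → f x y) l⊆y ⊆-refl ⟩
  f y y ∎
  where open ≡-Reasoning

intervalSum-chain-swap : (l y u : Subset n) (g : Subset n → Subset n → Subset n → Subset n → ℤ) →
  ∑[ x ∈ l ⋯ y ] ∑[ z ∈ y ⋯ u ] ∑[ a ∈ l ⋯ x ] ∑[ b ∈ z ⋯ u ] g a x z b ≡
  ∑[ a ∈ l ⋯ y ] ∑[ b ∈ y ⋯ u ] ∑[ x ∈ a ⋯ y ] ∑[ z ∈ y ⋯ b ] g a x z b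
intervalSum-chain-swap l y u g = begin
  ∑[ x ∈ l ⋯ y ] ∑[ z ∈ y ⋯ u ] ∑[ a ∈ l ⋯ x ] ∑[ b ∈ z ⋯ u ] g a x z b
    ≡⟨ intervalSum-cong l y (λ x → intervalSum-comm y u l x _) ⟩
  ∑[ x ∈ l ⋯ y ] ∑[ a ∈ l ⋯ x ] ∑[ z ∈ y ⋯ u ] ∑[ b ∈ z ⋯ u ] g a x z b
    ≡⟨ intervalSum-triangle l y _ ⟩
  ∑[ a ∈ l ⋯ y ] ∑[ x ∈ a ⋯ y ] ∑[ z ∈ y ⋯ u ] ∑[ b ∈ z ⋯ u ] g a x z b
    ≡⟨ intervalSum-cong l y (λ a → intervalSum-cong a y (λ x → sym (intervalSum-triangle y u _))) ⟩
  ∑[ a ∈ l ⋯ y ] ∑[ x ∈ a ⋯ y ] ∑[ b ∈ y ⋯ u ] ∑[ z ∈ y ⋯ b ] g a x z b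
    ≡⟨ intervalSum-cong l y (λ a → intervalSum-comm a y y u _) ⟩
  ∑[ a ∈ l ⋯ y ] ∑[ b ∈ y ⋯ u ] ∑[ x ∈ a ⋯ y ] ∑[ z ∈ y ⋯ b ] g a x z b ∎
  where open ≡-Reasoning

-- Pairing with the ζ-transforms of f and g undoes the convolution with ζ ⊗ ζ.
inverse-pairing : (l u y : Subset n) (K : Subset n → Subset n → ℤ) (f g : Subset n → ℤ) →
  l ⊆ y → y ⊆ u →
  (∀ x z → x ⊆ y → y ⊆ z → ∑[ a ∈ x ⋯ y ] ∑[ b ∈ y ⋯ z ] K a b ≡ δ₃ x y z) →
  ∑[ x ∈ l ⋯ y ] ∑[ z ∈ y ⋯ u ] (K x z * (∑[ a ∈ l ⋯ x ] f a * ∑[ b ∈ z ⋯ u ] g b)) ≡ f y * g y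
inverse-pairing l u y K f g l⊆y y⊆u K-inverse = begin
  ∑[ x ∈ l ⋯ y ] ∑[ z ∈ y ⋯ u ] (K x z * (∑[ a ∈ l ⋯ x ] f a * ∑[ b ∈ z ⋯ u ] g b))
    ≡⟨ intervalSum-cong l y (λ x → intervalSum-cong y u (λ z →
         trans (cong (K x z *_) (intervalSum-*-intervalSum l x z u f g))
               (sym (intervalSum²-*ˡ l x z u (K x z) _)))) ⟩
  ∑[ x ∈ l ⋯ y ] ∑[ z ∈ y ⋯ u ] ∑[ a ∈ l ⋯ x ] ∑[ b ∈ z ⋯ u ] (K x z * (f a * g b))
    ≡⟨ intervalSum-chain-swap l y u (λ a x z b → K x z * (f a * g b)) ⟩
  ∑[ a ∈ l ⋯ y ] ∑[ b ∈ y ⋯ u ] ∑[ x ∈ a ⋯ y ] ∑[ z ∈ y ⋯ b ] (K x z * (f a * g b))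
    ≡⟨ intervalSum-cong l y (λ a → intervalSum-cong y u (λ b → intervalSum²-*ʳ a y y b _ K)) ⟩
  ∑[ a ∈ l ⋯ y ] ∑[ b ∈ y ⋯ u ] ((∑[ x ∈ a ⋯ y ] ∑[ z ∈ y ⋯ b ] K x z) * (f a * g b))
    ≡⟨ intervalSum-cong-⊆ l y (λ a _ a⊆y → intervalSum-cong-⊆ y u (λ b y⊆b _ →
         cong (_* (f a * g b)) (K-inverse a b a⊆y y⊆b))) ⟩
  ∑[ a ∈ l ⋯ y ] ∑[ b ∈ y ⋯ u ] (δ₃ a y b * (f a * g b))
    ≡⟨ intervalSum²-δ₃ l u y (λ a b → f a * g b) l⊆y y⊆u ⟩
  f y * g y ∎
  where open ≡-Reasoning

∏ : (Bool → ℤ) → Subset n → ℤ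
∏ h []      = 1ℤ
∏ h (b ∷ v) = h b * ∏ h v

∏-cong : {g h : Bool → ℤ} → (∀ b → g b ≡ h b) → (v : Subset n) → ∏ g v ≡ ∏ h v
∏-cong g≗h []      = refl
∏-cong g≗h (b ∷ v) = cong₂ _*_ (g≗h b) (∏-cong g≗h v)

∏-* : (g h : Bool → ℤ) (v : Subset n) → ∏ g v * ∏ h v ≡ ∏ (λ b → g b * h b) v
∏-* g h []      = refl
∏-* g h (b ∷ v) = trans (*-interchange (g b) (∏ g v) (h b) (∏ h v)) (cong (g b * h b *_) (∏-* g h v))

∏-⊤ : (n : ℕ) (h : Bool → ℤ) → ∏ h (⊤ {n}) ≡ h true ^ n
∏-⊤ zero    h = refl
∏-⊤ (suc n) h = cong (h true *_) (∏-⊤ n h)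

sumBelow sumAbove : (Bool → ℤ) → Bool → ℤ
sumBelow h true  = h true + h false
sumBelow h false = h false
sumAbove h true  = h true
sumAbove h false = h true + h false

intervalSum-⊥-∏ : (h : Bool → ℤ) (u : Subset n) → ∑[ v ∈ ⊥ ⋯ u ] ∏ h v ≡ ∏ (sumBelow h) u
intervalSum-⊥-∏ h []          = refl
intervalSum-⊥-∏ h (true ∷ u)  = begin
  ∑[ v ∈ ⊥ ⋯ u ] (h true * ∏ h v) + ∑[ v ∈ ⊥ ⋯ u ] (h false * ∏ h v)
    ≡⟨ cong₂ _+_ (intervalSum-*ˡ ⊥ u (h true) (∏ h)) (intervalSum-*ˡ ⊥ u (h false) (∏ h)) ⟩
  h true * ∑[ v ∈ ⊥ ⋯ u ] ∏ h v + h false * ∑[ v ∈ ⊥ ⋯ u ] ∏ h v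
    ≡⟨ sym (ℤP.*-distribʳ-+ _ (h true) (h false)) ⟩
  (h true + h false) * ∑[ v ∈ ⊥ ⋯ u ] ∏ h v
    ≡⟨ cong ((h true + h false) *_) (intervalSum-⊥-∏ h u) ⟩
  (h true + h false) * ∏ (sumBelow h) u ∎
  where open ≡-Reasoning
intervalSum-⊥-∏ h (false ∷ u) =
  trans (intervalSum-*ˡ ⊥ u (h false) (∏ h)) (cong (h false *_) (intervalSum-⊥-∏ h u))

intervalSum-∏-⊤ : (h : Bool → ℤ) (l : Subset n) → ∑[ v ∈ l ⋯ ⊤ ] ∏ h v ≡ ∏ (sumAbove h) l
intervalSum-∏-⊤ h []          = refl
intervalSum-∏-⊤ h (true ∷ l)  =
  trans (intervalSum-*ˡ l ⊤ (h true) (∏ h)) (cong (h true *_) (intervalSum-∏-⊤ h l))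
intervalSum-∏-⊤ h (false ∷ l) = begin
  ∑[ v ∈ l ⋯ ⊤ ] (h true * ∏ h v) + ∑[ v ∈ l ⋯ ⊤ ] (h false * ∏ h v)
    ≡⟨ cong₂ _+_ (intervalSum-*ˡ l ⊤ (h true) (∏ h)) (intervalSum-*ˡ l ⊤ (h false) (∏ h)) ⟩
  h true * ∑[ v ∈ l ⋯ ⊤ ] ∏ h v + h false * ∑[ v ∈ l ⋯ ⊤ ] ∏ h v
    ≡⟨ sym (ℤP.*-distribʳ-+ _ (h true) (h false)) ⟩
  (h true + h false) * ∑[ v ∈ l ⋯ ⊤ ] ∏ h v
    ≡⟨ cong ((h true + h false) *_) (intervalSum-∏-⊤ h l) ⟩
  (h true + h false) * ∏ (sumAbove h) l ∎
  where open ≡-Reasoning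

intervalSum-⊥-∏-⊤ : (n : ℕ) (h : Bool → ℤ) → ∑[ v ∈ ⊥ {n} ⋯ ⊤ ] ∏ h v ≡ (h true + h false) ^ n
intervalSum-⊥-∏-⊤ n h = trans (intervalSum-⊥-∏ h (⊤ {n})) (∏-⊤ n (sumBelow h))

-- lowerWeight and upperWeight are the coordinatewise Möbius inverses of rankWeight
-- from below and from above.
rankWeight lowerWeight upperWeight flagWeight : ℤ → Bool → ℤ
rankWeight  t true  = 1ℤ
rankWeight  t false = t
lowerWeight t true  = 1ℤ - t
lowerWeight t false = t
upperWeight t true  = 1ℤ
upperWeight t false = t - 1ℤ
flagWeight  t b     = rankWeight t b * (lowerWeight t b * upperWeight t b)

sumBelow-lowerWeight : (t : ℤ) (b : Bool) → sumBelow (lowerWeight t) b ≡ rankWeight t b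
sumBelow-lowerWeight t true  = identity t
  where
  identity : ∀ t → (1ℤ - t) + t ≡ 1ℤ
  identity = solve-∀
sumBelow-lowerWeight t false = refl

sumAbove-upperWeight : (t : ℤ) (b : Bool) → sumAbove (upperWeight t) b ≡ rankWeight t b
sumAbove-upperWeight t true  = refl
sumAbove-upperWeight t false = identity t
  where
  identity : ∀ t → 1ℤ + (t - 1ℤ) ≡ t
  identity = solve-∀

flagWeight-sum : (t : ℤ) → flagWeight t true + flagWeight t false ≡ (t + 1ℤ) * (t - 1ℤ) ^ 2
flagWeight-sum t = identity t
  where
  -- the ring solver does not unfold the weights or _^_, so they are unfolded here
  identity : ∀ t → 1ℤ * ((1ℤ - t) * 1ℤ) + t * (t * (t - 1ℤ)) ≡ (t + 1ℤ) * ((t - 1ℤ) * ((t - 1ℤ) * 1ℤ))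
  identity = solve-∀

^-distribʳ-* : (a b : ℤ) (m : ℕ) → (a * b) ^ m ≡ a ^ m * b ^ m
^-distribʳ-* a b zero    = refl
^-distribʳ-* a b (suc m) =
  trans (cong (a * b *_) (^-distribʳ-* a b m)) (*-interchange a b (a ^ m) (b ^ m))

∏-rankWeight : (t : ℤ) (x : Subset n) → t ^ (n ∸ ∣ x ∣) ≡ ∏ (rankWeight t) x
∏-rankWeight t []          = refl
∏-rankWeight t (true ∷ x)  = trans (∏-rankWeight t x) (sym (ℤP.*-identityˡ _))
∏-rankWeight t (false ∷ x) =
  trans (cong (t ^_) (ℕP.+-∸-assoc 1 (∣p∣≤n x))) (cong (t *_) (∏-rankWeight t x))

3n∸a∸b∸c≡[n∸a]+[n∸b]+[n∸c] : (n a b c : ℕ) → a ≤ n → b ≤ n → c ≤ n →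
  3 ℕ.* n ∸ a ∸ b ∸ c ≡ (n ∸ a) ℕ.+ ((n ∸ b) ℕ.+ (n ∸ c))
3n∸a∸b∸c≡[n∸a]+[n∸b]+[n∸c] n a b c a≤n b≤n c≤n = begin
  n ℕ.+ (n ℕ.+ (n ℕ.+ 0)) ∸ a ∸ b ∸ c
    ≡⟨ cong (λ k → n ℕ.+ (n ℕ.+ k) ∸ a ∸ b ∸ c) (ℕP.+-identityʳ n) ⟩
  n ℕ.+ (n ℕ.+ n) ∸ a ∸ b ∸ c
    ≡⟨ cong (λ k → k ∸ b ∸ c) (ℕP.+-∸-comm (n ℕ.+ n) a≤n) ⟩
  (n ∸ a) ℕ.+ (n ℕ.+ n) ∸ b ∸ c
    ≡⟨ cong (_∸ c) (ℕP.+-∸-assoc (n ∸ a) (ℕP.≤-trans b≤n (ℕP.m≤m+n n n))) ⟩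
  (n ∸ a) ℕ.+ (n ℕ.+ n ∸ b) ∸ c
    ≡⟨ cong (λ k → (n ∸ a) ℕ.+ k ∸ c) (ℕP.+-∸-comm n b≤n) ⟩
  (n ∸ a) ℕ.+ ((n ∸ b) ℕ.+ n) ∸ c
    ≡⟨ ℕP.+-∸-assoc (n ∸ a) (ℕP.≤-trans c≤n (ℕP.m≤n+m n (n ∸ b))) ⟩
  (n ∸ a) ℕ.+ ((n ∸ b) ℕ.+ n ∸ c)
    ≡⟨ cong ((n ∸ a) ℕ.+_) (ℕP.+-∸-assoc (n ∸ b) c≤n) ⟩
  (n ∸ a) ℕ.+ ((n ∸ b) ℕ.+ (n ∸ c)) ∎
  where open ≡-Reasoning

rankWeight-exponent : (t : ℤ) (x y z : Subset n) →
  t ^ (3 ℕ.* n ∸ ∣ x ∣ ∸ ∣ y ∣ ∸ ∣ z ∣) ≡ ∏ (rankWeight t) x * ∏ (rankWeight t) y * ∏ (rankWeight t) z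
rankWeight-exponent {n} t x y z = begin
  t ^ (3 ℕ.* n ∸ ∣ x ∣ ∸ ∣ y ∣ ∸ ∣ z ∣)
    ≡⟨ cong (t ^_) (3n∸a∸b∸c≡[n∸a]+[n∸b]+[n∸c] n (∣ x ∣) (∣ y ∣) (∣ z ∣) (∣p∣≤n x) (∣p∣≤n y) (∣p∣≤n z)) ⟩
  t ^ ((n ∸ ∣ x ∣) ℕ.+ ((n ∸ ∣ y ∣) ℕ.+ (n ∸ ∣ z ∣)))
    ≡⟨ ℤP.^-distribˡ-+-* t (n ∸ ∣ x ∣) _ ⟩
  t ^ (n ∸ ∣ x ∣) * t ^ ((n ∸ ∣ y ∣) ℕ.+ (n ∸ ∣ z ∣))
    ≡⟨ cong (t ^ (n ∸ ∣ x ∣) *_) (ℤP.^-distribˡ-+-* t (n ∸ ∣ y ∣) _) ⟩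
  t ^ (n ∸ ∣ x ∣) * (t ^ (n ∸ ∣ y ∣) * t ^ (n ∸ ∣ z ∣))
    ≡⟨ sym (ℤP.*-assoc (t ^ (n ∸ ∣ x ∣)) _ _) ⟩
  t ^ (n ∸ ∣ x ∣) * t ^ (n ∸ ∣ y ∣) * t ^ (n ∸ ∣ z ∣)
    ≡⟨ cong₂ _*_ (cong₂ _*_ (∏-rankWeight t x) (∏-rankWeight t y)) (∏-rankWeight t z) ⟩
  ∏ (rankWeight t) x * ∏ (rankWeight t) y * ∏ (rankWeight t) z ∎
  where open ≡-Reasoning

rankWeighted-inverse-sum : (t : ℤ) (y : Subset n) (K : Subset n → Subset n → ℤ) →
  (∀ x z → x ⊆ y → y ⊆ z → ∑[ a ∈ x ⋯ y ] ∑[ b ∈ y ⋯ z ] K a b ≡ δ₃ x y z) →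
  ∑[ x ∈ ⊥ ⋯ y ] ∑[ z ∈ y ⋯ ⊤ ] (K x z * t ^ (3 ℕ.* n ∸ ∣ x ∣ ∸ ∣ y ∣ ∸ ∣ z ∣)) ≡ ∏ (flagWeight t) y
rankWeighted-inverse-sum {n} t y K K-inverse = begin
  ∑[ x ∈ ⊥ ⋯ y ] ∑[ z ∈ y ⋯ ⊤ ] (K x z * t ^ (3 ℕ.* n ∸ ∣ x ∣ ∸ ∣ y ∣ ∸ ∣ z ∣))
    ≡⟨ intervalSum-cong ⊥ y (λ x → intervalSum-cong y ⊤ (λ z →
         trans (cong (K x z *_) (rankWeight-exponent t x y z)) (rearrange (K x z) (W x) (W y) (W z)))) ⟩
  ∑[ x ∈ ⊥ ⋯ y ] ∑[ z ∈ y ⋯ ⊤ ] (W y * (K x z * (W x * W z)))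
    ≡⟨ intervalSum²-*ˡ ⊥ y y ⊤ (W y) _ ⟩
  W y * ∑[ x ∈ ⊥ ⋯ y ] ∑[ z ∈ y ⋯ ⊤ ] (K x z * (W x * W z))
    ≡⟨ cong (W y *_) (intervalSum-cong ⊥ y (λ x → intervalSum-cong y ⊤ (λ z →
         cong (K x z *_) (cong₂ _*_ (W-below x) (W-above z))))) ⟩
  W y * ∑[ x ∈ ⊥ ⋯ y ] ∑[ z ∈ y ⋯ ⊤ ]
          (K x z * (∑[ a ∈ ⊥ ⋯ x ] ∏ (lowerWeight t) a * ∑[ b ∈ z ⋯ ⊤ ] ∏ (upperWeight t) b))
    ≡⟨ cong (W y *_) (inverse-pairing ⊥ ⊤ y K (∏ (lowerWeight t)) (∏ (upperWeight t)) ⊥⊆ ⊆⊤ K-inverse) ⟩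
  W y * (∏ (lowerWeight t) y * ∏ (upperWeight t) y)
    ≡⟨ cong (W y *_) (∏-* (lowerWeight t) (upperWeight t) y) ⟩
  W y * ∏ (λ b → lowerWeight t b * upperWeight t b) y
    ≡⟨ ∏-* (rankWeight t) _ y ⟩
  ∏ (flagWeight t) y ∎
  where
  open ≡-Reasoning
  W : Subset _ → ℤ
  W = ∏ (rankWeight t)
  W-below : ∀ x → W x ≡ ∑[ a ∈ ⊥ ⋯ x ] ∏ (lowerWeight t) a
  W-below x = sym (trans (intervalSum-⊥-∏ (lowerWeight t) x) (∏-cong (sumBelow-lowerWeight t) x))
  W-above : ∀ z → W z ≡ ∑[ b ∈ z ⋯ ⊤ ] ∏ (upperWeight t) b
  W-above z = sym (trans (intervalSum-∏-⊤ (upperWeight t) z) (∏-cong (sumAbove-upperWeight t) z))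
  rearrange : ∀ k a w b → k * (a * w * b) ≡ w * (k * (a * b))
  rearrange = solve-∀

sumℤ-++ : (xs ys : List ℤ) → sumℤ (xs ++ ys) ≡ sumℤ xs + sumℤ ys
sumℤ-++ []       ys = sym (ℤP.+-identityˡ _)
sumℤ-++ (x ∷ xs) ys = trans (cong (x +_) (sumℤ-++ xs ys)) (sym (ℤP.+-assoc x _ _))

sumℤ-map-++ : {A : Set} (f : A → ℤ) (xs ys : List A) →
              sumℤ (map f (xs ++ ys)) ≡ sumℤ (map f xs) + sumℤ (map f ys)
sumℤ-map-++ f xs ys = trans (cong sumℤ (ListP.map-++ f xs ys)) (sumℤ-++ (map f xs) (map f ys))

module _ {A B : Set} {P : Pred A 0ℓ} (P? : Decidable P) (g : B → A) where

  filter-map-≐ : {Q : Pred B 0ℓ} (Q? : Decidable Q) → (∀ b → does (P? (g b)) ≡ does (Q? b)) →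
                 (L : List B) → filter P? (map g L) ≡ map g (filter Q? L)
  filter-map-≐ Q? same []      = refl
  filter-map-≐ Q? same (b ∷ L) with does (P? (g b)) | does (Q? b) | same b
  ... | true  | .true  | refl = cong (g b ∷_) (filter-map-≐ Q? same L)
  ... | false | .false | refl = filter-map-≐ Q? same L

  filter-map-reject : (∀ b → does (P? (g b)) ≡ false) →
                      (L : List B) → filter P? (map g L) ≡ []
  filter-map-reject reject []      = refl
  filter-map-reject reject (b ∷ L) with does (P? (g b)) | reject b
  ... | false | refl = filter-map-reject reject L

filterInterval : Subset n → Subset n → List (Subset n) → List (Subset n)
filterInterval x y L = filter (x ⊆?_) (filter (_⊆? y) L)

module _ {n : ℕ} (x y : Subset n) where

  filterInterval-++ : ∀ {b c} (L L′ : List (Subset (suc n))) →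
    filterInterval (b ∷ x) (c ∷ y) (L ++ L′) ≡
    filterInterval (b ∷ x) (c ∷ y) L ++ filterInterval (b ∷ x) (c ∷ y) L′
  filterInterval-++ {b} {c} L L′ =
    trans (cong (filter ((b ∷ x) ⊆?_)) (ListP.filter-++ (_⊆? (c ∷ y)) L L′))
          (ListP.filter-++ ((b ∷ x) ⊆?_) (filter (_⊆? (c ∷ y)) L) _)

  filterInterval-map-∷ : ∀ {b c d} (L : List (Subset n)) →
    (∀ v → does ((b ∷ x) ⊆? (d ∷ v)) ≡ does (x ⊆? v)) →
    (∀ v → does ((d ∷ v) ⊆? (c ∷ y)) ≡ does (v ⊆? y)) →
    filterInterval (b ∷ x) (c ∷ y) (map (d ∷_) L) ≡ map (d ∷_) (filterInterval x y L)
  filterInterval-map-∷ {b} {c} {d} L lower upper =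
    trans (cong (filter ((b ∷ x) ⊆?_))
                (filter-map-≐ (_⊆? (c ∷ y)) (d ∷_) (_⊆? y) upper L))
          (filter-map-≐ ((b ∷ x) ⊆?_) (d ∷_) (x ⊆?_) lower (filter (_⊆? y) L))

  filterInterval-below : ∀ {c} (L : List (Subset n)) →
    filterInterval (true ∷ x) (c ∷ y) (map (false ∷_) L) ≡ []
  filterInterval-below {c} L =
    trans (cong (filter ((true ∷ x) ⊆?_))
                (filter-map-≐ (_⊆? (c ∷ y)) (false ∷_) (_⊆? y) (λ _ → refl) L))
          (filter-map-reject ((true ∷ x) ⊆?_) (false ∷_) (λ _ → refl) (filter (_⊆? y) L))

  filterInterval-above : ∀ {b} (L : List (Subset n)) →
    filterInterval (b ∷ x) (false ∷ y) (map (true ∷_) L) ≡ []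
  filterInterval-above {b} L =
    cong (filter ((b ∷ x) ⊆?_))
         (filter-map-reject (_⊆? (false ∷ y)) (true ∷_) (λ _ → refl) L)

module _ (x y : Subset n) (f : Subset (suc n) → ℤ) where

  sumIntervalPart : Bool → Bool → Bool → ℤ
  sumIntervalPart b c d = sumℤ (map f (filterInterval (b ∷ x) (c ∷ y) (map (d ∷_) (allSubsets n))))

  sumInterval-∷ : ∀ b c →
    sumInterval (b ∷ x) (c ∷ y) f ≡ sumIntervalPart b c true + sumIntervalPart b c false
  sumInterval-∷ b c =
    trans (cong (sumℤ ∘ map f) (filterInterval-++ x y (map (true ∷_) A) (map (false ∷_) A)))
          (sumℤ-map-++ f (filterInterval (b ∷ x) (c ∷ y) (map (true ∷_) A)) _)
    where A = allSubsets n

  sumIntervalPart-inside : ∀ {b c d} →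
    (∀ v → does ((b ∷ x) ⊆? (d ∷ v)) ≡ does (x ⊆? v)) →
    (∀ v → does ((d ∷ v) ⊆? (c ∷ y)) ≡ does (v ⊆? y)) →
    sumIntervalPart b c d ≡ sumInterval x y (f ∘ (d ∷_))
  sumIntervalPart-inside lower upper =
    trans (cong (sumℤ ∘ map f) (filterInterval-map-∷ x y (allSubsets n) lower upper))
          (cong sumℤ (sym (ListP.map-∘ (filterInterval x y (allSubsets n)))))

  sumIntervalPart-below : ∀ {c} → sumIntervalPart true c false ≡ 0ℤ
  sumIntervalPart-below = cong (sumℤ ∘ map f) (filterInterval-below x y (allSubsets n))

  sumIntervalPart-above : ∀ {b} → sumIntervalPart b false true ≡ 0ℤ
  sumIntervalPart-above = cong (sumℤ ∘ map f) (filterInterval-above x y (allSubsets n))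

sumInterval≡intervalSum : (x y : Subset n) (f : Subset n → ℤ) → sumInterval x y f ≡ intervalSum x y f
sumInterval≡intervalSum []          []          f = ℤP.+-identityʳ (f [])
sumInterval≡intervalSum (true ∷ x)  (true ∷ y)  f = begin
  sumInterval (true ∷ x) (true ∷ y) f                           ≡⟨ sumInterval-∷ x y f true true ⟩
  sumIntervalPart x y f true true true + sumIntervalPart x y f true true false
    ≡⟨ cong₂ _+_ (sumIntervalPart-inside x y f (λ _ → refl) (λ _ → refl)) (sumIntervalPart-below x y f) ⟩
  sumInterval x y (f ∘ (true ∷_)) + 0ℤ                          ≡⟨ ℤP.+-identityʳ _ ⟩
  sumInterval x y (f ∘ (true ∷_))                               ≡⟨ sumInterval≡intervalSum x y _ ⟩
  intervalSum (true ∷ x) (true ∷ y) f                           ∎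
  where open ≡-Reasoning
sumInterval≡intervalSum (true ∷ x)  (false ∷ y) f =
  trans (sumInterval-∷ x y f true false)
        (cong₂ _+_ (sumIntervalPart-above x y f) (sumIntervalPart-below x y f))
sumInterval≡intervalSum (false ∷ x) (true ∷ y)  f =
  trans (sumInterval-∷ x y f false true)
        (cong₂ _+_ (trans (sumIntervalPart-inside x y f (λ _ → refl) (λ _ → refl))
                          (sumInterval≡intervalSum x y _))
                   (trans (sumIntervalPart-inside x y f (λ _ → refl) (λ _ → refl))
                          (sumInterval≡intervalSum x y _)))
sumInterval≡intervalSum (false ∷ x) (false ∷ y) f = begin
  sumInterval (false ∷ x) (false ∷ y) f                         ≡⟨ sumInterval-∷ x y f false false ⟩
  sumIntervalPart x y f false false true + sumIntervalPart x y f false false false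
    ≡⟨ cong₂ _+_ (sumIntervalPart-above x y f) (sumIntervalPart-inside x y f (λ _ → refl) (λ _ → refl)) ⟩
  0ℤ + sumInterval x y (f ∘ (false ∷_))                         ≡⟨ ℤP.+-identityˡ _ ⟩
  sumInterval x y (f ∘ (false ∷_))                              ≡⟨ sumInterval≡intervalSum x y _ ⟩
  intervalSum (false ∷ x) (false ∷ y) f                         ∎
  where open ≡-Reasoning

sumInterval²≡intervalSum² : (x y z : Subset n) (f : Subset n → Subset n → ℤ) →
  sumInterval x y (λ a → sumInterval y z (f a)) ≡ ∑[ a ∈ x ⋯ y ] ∑[ b ∈ y ⋯ z ] f a b
sumInterval²≡intervalSum² x y z f =
  trans (sumInterval≡intervalSum x y _) (intervalSum-cong x y (λ a → sumInterval≡intervalSum y z (f a)))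

M≡intervalSum : (n : ℕ) (J : Subset n → Subset n → Subset n → ℤ) (t : ℤ) →
  M n J t ≡
  ∑[ y ∈ ⊥ ⋯ ⊤ ] ∑[ x ∈ ⊥ ⋯ y ] ∑[ z ∈ y ⋯ ⊤ ] (J x y z * t ^ (3 ℕ.* n ∸ ∣ x ∣ ∸ ∣ y ∣ ∸ ∣ z ∣))
M≡intervalSum n J t =
  trans (sumInterval≡intervalSum (⊥ {n}) ⊤ _)
        (intervalSum-cong (⊥ {n}) ⊤ (λ y → sumInterval²≡intervalSum² ⊥ y ⊤ _))

IsJ-intervalSum : (n : ℕ) (J : Subset n → Subset n → Subset n → ℤ) → IsJ n J →
  ∀ y x z → x ⊆ y → y ⊆ z → ∑[ a ∈ x ⋯ y ] ∑[ b ∈ y ⋯ z ] J a y b ≡ δ₃ x y z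
IsJ-intervalSum n J isJ y x z x⊆y y⊆z =
  trans (sym (sumInterval²≡intervalSum² x y z (λ a b → J a y b))) (isJ x y z x⊆y y⊆z)

proposition6p8 : (n : ℕ) (J : Subset n → Subset n → Subset n → ℤ) → IsJ n J →
    (t : ℤ) → M n J t ≡ ((t + 1ℤ) ^ n) * ((t - 1ℤ) ^ (2 Data.Nat.* n))
proposition6p8 n J isJ t = begin
  M n J t
    ≡⟨ M≡intervalSum n J t ⟩
  ∑[ y ∈ ⊥ ⋯ ⊤ ] ∑[ x ∈ ⊥ ⋯ y ] ∑[ z ∈ y ⋯ ⊤ ] (J x y z * t ^ (3 ℕ.* n ∸ ∣ x ∣ ∸ ∣ y ∣ ∸ ∣ z ∣))
    ≡⟨ intervalSum-cong (⊥ {n}) ⊤ (λ y →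
         rankWeighted-inverse-sum t y (λ x z → J x y z) (IsJ-intervalSum n J isJ y)) ⟩
  ∑[ y ∈ ⊥ {n} ⋯ ⊤ ] ∏ (flagWeight t) y
    ≡⟨ intervalSum-⊥-∏-⊤ n (flagWeight t) ⟩
  (flagWeight t true + flagWeight t false) ^ n
    ≡⟨ cong (_^ n) (flagWeight-sum t) ⟩
  ((t + 1ℤ) * (t - 1ℤ) ^ 2) ^ n
    ≡⟨ ^-distribʳ-* (t + 1ℤ) ((t - 1ℤ) ^ 2) n ⟩
  (t + 1ℤ) ^ n * ((t - 1ℤ) ^ 2) ^ n
    ≡⟨ cong ((t + 1ℤ) ^ n *_) (ℤP.^-*-assoc (t - 1ℤ) 2 n) ⟩
  (t + 1ℤ) ^ n * (t - 1ℤ) ^ (2 ℕ.* n) ∎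
  where open ≡-Reasoning
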